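{- Let $d\ge 6$, let $a:=\lfloor (d+3)/2\rfloor+1$, let $b$ be an integer with $a\le b\le d$, and let $m$ be an integer with $3\le m\le \lfloor b/2\rfloor$. Let $Q$ be the $(d-b)$-fold pyramid over $T(m)\times T(b-m)$ and let $P$ be the $(d-a)$-fold pyramid over $T(2)\times T(a-2)$. Then for each $k\in\{0,1,\dots,d-3\}$, $f_k(Q)>f_k(P)$.
   Context: $T(n)$ denotes the $n$-simplex, $\times$ the Cartesian product of polytopes, and an $r$-fold pyramid over $Q$ is obtained by taking a pyramid $r$ times in succession (a $0$-fold pyramid is the polytope itself). $f_k$ denotes the number of $k$-dimensional faces. (In the paper these polytopes are denoted $(T_m^{d,d-b})^*$ and $(T_2^{d,d-a})^*$, the duals of the $(d-b)$-fold pyramid over the direct sum $T(m)\oplus T(b-m)$, resp. of the $(d-a)$-fold pyramid over $T(2)\oplus T(a-2)$.) -}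

module Defs where

-- A polytope is represented by
-- its vertex type together with the complete list of its faces (including the
-- empty face, of dimension -1, and the polytope itself); each face is given by
-- its vertex set (a Bool-valued predicate on vertices) and its dimension.

open import Data.Bool using (Bool; true; false; _∧_)
open import Data.Nat using (ℕ; zero; suc)
open import Data.Integer using (ℤ; +_; -[1+_]; _+_; _-_; _≤?_)
open import Data.Fin using (Fin)
open import Data.Vec using (Vec; []; _∷_; lookup; count)
open import Data.List using (List; []; _∷_; map; concatMap; filter; length)
open import Data.Maybe using (Maybe; just; nothing)
open import Data.Product using (_×_; _,_; proj₂)
open import Relation.Nullary using (does)
import Data.Integer as ℤ

record CombPolytope : Set₁ where
  field
    Vert  : Set
    faces : List ((Vert → Bool) × ℤ)
open CombPolytope public

subsets : (n : ℕ) → List (Vec Bool n)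
subsets zero = [] ∷ []
subsets (suc n) = concatMap (λ s → (false ∷ s) ∷ (true ∷ s) ∷ []) (subsets n)

countTrue : ∀ {n} → Vec Bool n → ℕ
countTrue [] = 0
countTrue (true ∷ v) = suc (countTrue v)
countTrue (false ∷ v) = countTrue v

T : ℕ → CombPolytope
T n = record
  { Vert  = Fin (suc n)
  ; faces = map (λ S → (λ i → lookup S i) , (+ countTrue S) - + 1) (subsets (suc n)) }

isNonempty : ∀ {V : Set} → (V → Bool) × ℤ → Bool
isNonempty (_ , d) = does (+ 0 ≤? d)

_×ₚ_ : CombPolytope → CombPolytope → CombPolytope
P ×ₚ Q = record
  { Vert  = Vert P × Vert Q
  ; faces = ((λ _ → false) , -[1+ 0 ])
            ∷ concatMap (λ { (F , d) → map (λ { (G , e) → (λ { (x , y) → F x ∧ G y }) , d + e })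
                                               (filter (λ f → Data.Bool.T? (isNonempty {Vert Q} f)) (faces Q)) })
                        (filter (λ f → Data.Bool.T? (isNonempty {Vert P} f)) (faces P)) }

pyr : CombPolytope → CombPolytope
pyr P = record
  { Vert  = Maybe (Vert P)
  ; faces = concatMap (λ { (F , d) →
                 ((λ { nothing → false ; (just x) → F x }) , d)
               ∷ ((λ { nothing → true ; (just x) → F x }) , d + + 1)
               ∷ [] }) (faces P) }

pyrIter : ℕ → CombPolytope → CombPolytope
pyrIter zero P = P
pyrIter (suc r) P = pyr (pyrIter r P)

f : ℕ → CombPolytope → ℕ
f k P = length (filter (λ fd → proj₂ fd ℤ.≟ + k) (faces P))

-- Sorting faces by the sizes of their vertex sets, the k-faces of the r-fold pyramid over
-- T p × T q satisfy f_k + C(r+p+1, k+2) + C(r+q+1, k+2) = C(r+p+q+2, k+2) + C(r+1, k+2)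
-- (Vandermonde's identity and inclusion–exclusion over the empty factors).  Both polytopes
-- have r + p + q = d, so f_k(P) < f_k(Q) becomes an inequality between binomial
-- coefficients, which follows from the supermodularity of n ↦ C(n, k+2) and Pascal's rule.
-- For d = 6 one has a = 5 and the only case b = 6, m = 3 is checked by computation.
module Submission where

open import Defs
open import Data.Nat using (ℕ; zero; suc; _+_; _*_; _∸_; _≤_; _<_; _≡ᵇ_; z≤n; s≤s; _≤′_; ≤′-refl; ≤′-step)
open import Data.Nat.Properties
open import Data.Nat.DivMod using (_/_; m/n*n≤m; /-monoˡ-≤)
open import Data.Nat.Combinatorics using (_C_; nCn≡1; nCk+nC[k+1]≡[n+1]C[k+1])
open import Data.Nat.Tactic.RingSolver using (solve-∀)
open import Data.Bool using (Bool; true; false; if_then_else_; T?)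
open import Data.Integer as ℤ using (ℤ; -[1+_])
import Data.Integer.Properties as ℤ
open import Data.List using (List; []; _∷_; map; concatMap; filter; length; _++_)
open import Data.Product using (_×_; proj₂)
open import Data.Sum using (inj₁; inj₂)
open import Relation.Nullary using (does)
open import Relation.Nullary.Decidable using (toWitness)
open import Relation.Unary using (Pred; Decidable)
open import Relation.Binary.PropositionalEquality
open import Algebra.Properties.CommutativeSemigroup +-commutativeSemigroup using (interchange)

private
  variable
    A B : Set
    g h : A → ℕ

sumBy : (A → ℕ) → List A → ℕ
sumBy g []       = 0
sumBy g (x ∷ xs) = g x + sumBy g xs

sumBy-cong : (∀ x → g x ≡ h x) → (xs : List A) → sumBy g xs ≡ sumBy h xs
sumBy-cong g≗h []       = refl
sumBy-cong g≗h (x ∷ xs) = cong₂ _+_ (g≗h x) (sumBy-cong g≗h xs)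

sumBy-+ : (g h : A → ℕ) (xs : List A) → sumBy (λ x → g x + h x) xs ≡ sumBy g xs + sumBy h xs
sumBy-+ g h []       = refl
sumBy-+ g h (x ∷ xs) = trans (cong ((g x + h x) +_) (sumBy-+ g h xs)) (interchange (g x) (h x) _ _)

sumBy-++ : (g : A → ℕ) (xs ys : List A) → sumBy g (xs ++ ys) ≡ sumBy g xs + sumBy g ys
sumBy-++ g []       ys = refl
sumBy-++ g (x ∷ xs) ys = trans (cong (g x +_) (sumBy-++ g xs ys)) (sym (+-assoc (g x) _ _))

sumBy-map : (g : B → ℕ) (h : A → B) (xs : List A) → sumBy g (map h xs) ≡ sumBy (λ x → g (h x)) xs
sumBy-map g h []       = refl
sumBy-map g h (x ∷ xs) = cong (g (h x) +_) (sumBy-map g h xs)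

sumBy-concatMap : (g : B → ℕ) (h : A → List B) (xs : List A) →
  sumBy g (concatMap h xs) ≡ sumBy (λ x → sumBy g (h x)) xs
sumBy-concatMap g h []       = refl
sumBy-concatMap g h (x ∷ xs) =
  trans (sumBy-++ g (h x) (concatMap h xs)) (cong (sumBy g (h x) +_) (sumBy-concatMap g h xs))

sumBy-filter : ∀ {p} {P : Pred A p} (g : A → ℕ) (P? : Decidable P) (xs : List A) →
  sumBy g (filter P? xs) ≡ sumBy (λ x → if does (P? x) then g x else 0) xs
sumBy-filter g P? []       = refl
sumBy-filter g P? (x ∷ xs) with does (P? x)
... | true  = cong (g x +_) (sumBy-filter g P? xs)
... | false = sumBy-filter g P? xs

sumBy-0 : (xs : List A) → sumBy (λ _ → 0) xs ≡ 0
sumBy-0 []       = refl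
sumBy-0 (x ∷ xs) = sumBy-0 xs

length≡sumBy-1 : (xs : List A) → length xs ≡ sumBy (λ _ → 1) xs
length≡sumBy-1 []       = refl
length≡sumBy-1 (x ∷ xs) = cong suc (length≡sumBy-1 xs)

𝟙 : Bool → ℕ
𝟙 b = if b then 1 else 0

∑⊆ : ℕ → (ℕ → ℕ) → ℕ
∑⊆ n g = sumBy (λ S → g (countTrue S)) (subsets n)

_⁺ : (ℕ → ℕ) → ℕ → ℕ
(g ⁺) zero    = 0
(g ⁺) (suc s) = g (suc s)

∑⊆⁺ : ℕ → (ℕ → ℕ) → ℕ
∑⊆⁺ n g = ∑⊆ n (g ⁺)

∑⊆-cong : ∀ n {g h : ℕ → ℕ} → (∀ s → g s ≡ h s) → ∑⊆ n g ≡ ∑⊆ n h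
∑⊆-cong n g≗h = sumBy-cong (λ S → g≗h (countTrue S)) (subsets n)

∑⊆⁺-cong : ∀ n {g h : ℕ → ℕ} → (∀ s → g (suc s) ≡ h (suc s)) → ∑⊆⁺ n g ≡ ∑⊆⁺ n h
∑⊆⁺-cong n {g} {h} g≗h = ∑⊆-cong n {g ⁺} {h ⁺} λ { zero → refl ; (suc s) → g≗h s }

∑⊆-+ : ∀ n (g h : ℕ → ℕ) → ∑⊆ n (λ s → g s + h s) ≡ ∑⊆ n g + ∑⊆ n h
∑⊆-+ n g h = sumBy-+ (λ S → g (countTrue S)) (λ S → h (countTrue S)) (subsets n)

∑⊆-suc : ∀ n (g : ℕ → ℕ) → ∑⊆ (suc n) g ≡ ∑⊆ n g + ∑⊆ n (λ s → g (suc s))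
∑⊆-suc n g = begin
  ∑⊆ (suc n) g
    ≡⟨ sumBy-concatMap _ _ (subsets n) ⟩
  sumBy (λ S → g (countTrue S) + (g (suc (countTrue S)) + 0)) (subsets n)
    ≡⟨ sumBy-cong (λ S → cong (g (countTrue S) +_) (+-identityʳ _)) (subsets n) ⟩
  ∑⊆ n (λ s → g s + g (suc s))
    ≡⟨ ∑⊆-+ n g (λ s → g (suc s)) ⟩
  ∑⊆ n g + ∑⊆ n (λ s → g (suc s)) ∎
  where open ≡-Reasoning

∑⊆-split : ∀ n (g : ℕ → ℕ) → ∑⊆ n g ≡ g 0 + ∑⊆⁺ n g
∑⊆-split zero    g = refl
∑⊆-split (suc n) g = begin
  ∑⊆ (suc n) g                                    ≡⟨ ∑⊆-suc n g ⟩
  ∑⊆ n g + ∑⊆ n (λ s → g (suc s))                 ≡⟨ cong (_+ ∑⊆ n (λ s → g (suc s))) (∑⊆-split n g) ⟩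
  g 0 + ∑⊆⁺ n g + ∑⊆ n (λ s → g (suc s))          ≡⟨ +-assoc (g 0) (∑⊆⁺ n g) _ ⟩
  g 0 + (∑⊆⁺ n g + ∑⊆ n (λ s → (g ⁺) (suc s)))    ≡⟨ cong (g 0 +_) (∑⊆-suc n (g ⁺)) ⟨
  g 0 + ∑⊆⁺ (suc n) g                             ∎
  where open ≡-Reasoning

∑⊆-convolution : ∀ m n (h : ℕ → ℕ) → ∑⊆ m (λ s → ∑⊆ n (λ t → h (s + t))) ≡ ∑⊆ (m + n) h
∑⊆-convolution zero    n h = +-identityʳ (∑⊆ n h)
∑⊆-convolution (suc m) n h = begin
  ∑⊆ (suc m) (λ s → ∑⊆ n (λ t → h (s + t)))
    ≡⟨ ∑⊆-suc m (λ s → ∑⊆ n (λ t → h (s + t))) ⟩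
  ∑⊆ m (λ s → ∑⊆ n (λ t → h (s + t))) + ∑⊆ m (λ s → ∑⊆ n (λ t → h (suc (s + t))))
    ≡⟨ cong₂ _+_ (∑⊆-convolution m n h) (∑⊆-convolution m n (λ x → h (suc x))) ⟩
  ∑⊆ (m + n) h + ∑⊆ (m + n) (λ x → h (suc x))
    ≡⟨ ∑⊆-suc (m + n) h ⟨
  ∑⊆ (suc m + n) h ∎
  where open ≡-Reasoning

-- Inclusion–exclusion for the pairs of nonempty subsets.
∑⊆⁺-pairs : ∀ m n (h : ℕ → ℕ) →
  ∑⊆⁺ m (λ s → ∑⊆⁺ n (λ t → h (s + t))) + ∑⊆ m h + ∑⊆ n h ≡ ∑⊆ (m + n) h + h 0
∑⊆⁺-pairs m n h = begin
  ∑⊆⁺ m X + ∑⊆ m h + ∑⊆ n h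
    ≡⟨ cong (∑⊆⁺ m X + ∑⊆ m h +_) (∑⊆-split n h) ⟩
  ∑⊆⁺ m X + ∑⊆ m h + (h 0 + X 0)
    ≡⟨ shuffle (∑⊆⁺ m X) (∑⊆ m h) (h 0) (X 0) ⟩
  ∑⊆ m h + (X 0 + ∑⊆⁺ m X) + h 0
    ≡⟨ cong (λ x → ∑⊆ m h + x + h 0) (∑⊆-split m X) ⟨
  ∑⊆ m h + ∑⊆ m X + h 0
    ≡⟨ cong (_+ h 0) (∑⊆-+ m h X) ⟨
  ∑⊆ m (λ s → h s + X s) + h 0
    ≡⟨ cong (_+ h 0) (∑⊆-cong m λ s → sym (row s)) ⟩
  ∑⊆ m (λ s → ∑⊆ n (λ t → h (s + t))) + h 0
    ≡⟨ cong (_+ h 0) (∑⊆-convolution m n h) ⟩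
  ∑⊆ (m + n) h + h 0 ∎
  where
  open ≡-Reasoning
  X : ℕ → ℕ
  X s = ∑⊆⁺ n (λ t → h (s + t))
  row : ∀ s → ∑⊆ n (λ t → h (s + t)) ≡ h s + X s
  row s = trans (∑⊆-split n (λ t → h (s + t))) (cong (λ x → h x + X s) (+-identityʳ s))
  shuffle : ∀ a b c d → a + b + (c + d) ≡ b + (d + a) + c
  shuffle = solve-∀

∑⊆-indicator : ∀ n j → ∑⊆ n (λ s → 𝟙 (s ≡ᵇ j)) ≡ n C j
∑⊆-indicator zero    zero    = refl
∑⊆-indicator zero    (suc j) = refl
∑⊆-indicator (suc n) zero    =
  trans (∑⊆-suc n (λ s → 𝟙 (s ≡ᵇ 0))) (cong₂ _+_ (∑⊆-indicator n zero) (sumBy-0 (subsets n)))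
∑⊆-indicator (suc n) (suc j) = begin
  ∑⊆ (suc n) (λ s → 𝟙 (s ≡ᵇ suc j))   ≡⟨ ∑⊆-suc n (λ s → 𝟙 (s ≡ᵇ suc j)) ⟩
  ∑⊆ n (λ s → 𝟙 (s ≡ᵇ suc j)) + ∑⊆ n (λ s → 𝟙 (s ≡ᵇ j))
                                      ≡⟨ cong₂ _+_ (∑⊆-indicator n (suc j)) (∑⊆-indicator n j) ⟩
  n C suc j + n C j                   ≡⟨ +-comm (n C suc j) (n C j) ⟩
  n C j + n C suc j                   ≡⟨ nCk+nC[k+1]≡[n+1]C[k+1] n j ⟩
  suc n C suc j                       ∎
  where open ≡-Reasoning

faceSum : CombPolytope → (ℤ → ℕ) → ℕ
faceSum P w = sumBy (λ F → w (proj₂ F)) (faces P)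

nonemptyFaces : (P : CombPolytope) → List ((Vert P → Bool) × ℤ)
nonemptyFaces P = filter (λ F → T? (isNonempty {Vert P} F)) (faces P)

faceSum⁺ : CombPolytope → (ℤ → ℕ) → ℕ
faceSum⁺ P w = sumBy (λ F → w (proj₂ F)) (nonemptyFaces P)

faceSum-cong : ∀ P {v w : ℤ → ℕ} → (∀ z → v z ≡ w z) → faceSum P v ≡ faceSum P w
faceSum-cong P v≗w = sumBy-cong (λ F → v≗w (proj₂ F)) (faces P)

f≡faceSum : ∀ k P → f k P ≡ faceSum P (λ z → 𝟙 (does (z ℤ.≟ ℤ.+ k)))
f≡faceSum k P = trans (length≡sumBy-1 (filter _ (faces P))) (sumBy-filter (λ _ → 1) _ (faces P))

faceSum-pyr : ∀ P (w : ℤ → ℕ) → faceSum (pyr P) w ≡ faceSum P w + faceSum P (λ z → w (z ℤ.+ ℤ.+ 1))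
faceSum-pyr P w = begin
  faceSum (pyr P) w
    ≡⟨ sumBy-concatMap _ _ (faces P) ⟩
  sumBy (λ F → w (proj₂ F) + (w (proj₂ F ℤ.+ ℤ.+ 1) + 0)) (faces P)
    ≡⟨ sumBy-cong (λ F → cong (w (proj₂ F) +_) (+-identityʳ _)) (faces P) ⟩
  sumBy (λ F → w (proj₂ F) + w (proj₂ F ℤ.+ ℤ.+ 1)) (faces P)
    ≡⟨ sumBy-+ _ _ (faces P) ⟩
  faceSum P w + faceSum P (λ z → w (z ℤ.+ ℤ.+ 1)) ∎
  where open ≡-Reasoning

-- A face of the r-fold pyramid is a face of the base joined with a set of apices.
faceSum-pyrIter : ∀ r P (w : ℤ → ℕ) → faceSum (pyrIter r P) w ≡ ∑⊆ r (λ a → faceSum P (λ z → w (z ℤ.+ ℤ.+ a)))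
faceSum-pyrIter zero    P w =
  trans (faceSum-cong P λ z → cong w (sym (ℤ.+-identityʳ z))) (sym (+-identityʳ _))
faceSum-pyrIter (suc r) P w = begin
  faceSum (pyr (pyrIter r P)) w
    ≡⟨ faceSum-pyr (pyrIter r P) w ⟩
  faceSum (pyrIter r P) w + faceSum (pyrIter r P) (λ z → w (z ℤ.+ ℤ.+ 1))
    ≡⟨ cong₂ _+_ (faceSum-pyrIter r P w) (faceSum-pyrIter r P (λ z → w (z ℤ.+ ℤ.+ 1))) ⟩
  ∑⊆ r (λ a → faceSum P (λ z → w (z ℤ.+ ℤ.+ a))) + ∑⊆ r (λ a → faceSum P (λ z → w (z ℤ.+ ℤ.+ a ℤ.+ ℤ.+ 1)))
    ≡⟨ cong (∑⊆ r base+ +_) (∑⊆-cong r λ a → faceSum-cong P λ z → cong w (apex-last z a)) ⟩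
  ∑⊆ r base+ + ∑⊆ r (λ a → base+ (suc a))
    ≡⟨ ∑⊆-suc r base+ ⟨
  ∑⊆ (suc r) base+ ∎
  where
  open ≡-Reasoning
  base+ : ℕ → ℕ
  base+ a = faceSum P (λ z → w (z ℤ.+ ℤ.+ a))
  apex-last : ∀ z a → z ℤ.+ ℤ.+ a ℤ.+ ℤ.+ 1 ≡ z ℤ.+ ℤ.+ suc a
  apex-last z a = trans (ℤ.+-assoc z (ℤ.+ a) (ℤ.+ 1)) (cong (λ n → z ℤ.+ ℤ.+ n) (+-comm a 1))

faceSum-×ₚ : ∀ P Q (w : ℤ → ℕ) →
  faceSum (P ×ₚ Q) w ≡ w -[1+ 0 ] + faceSum⁺ P (λ d → faceSum⁺ Q (λ e → w (d ℤ.+ e)))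
faceSum-×ₚ P Q w = cong (w -[1+ 0 ] +_)
  (trans (sumBy-concatMap _ _ (nonemptyFaces P))
         (sumBy-cong (λ F → sumBy-map _ _ (nonemptyFaces Q)) (nonemptyFaces P)))

faceSum⁺-T : ∀ n (w : ℤ → ℕ) → faceSum⁺ (T n) w ≡ ∑⊆⁺ (suc n) (λ s → w (ℤ.+ s ℤ.- ℤ.+ 1))
faceSum⁺-T n w =
  trans (sumBy-filter _ _ (faces (T n)))
    (trans (sumBy-map _ _ (subsets (suc n)))
           (sumBy-cong (λ S → nonempty⇔positive (countTrue S)) (subsets (suc n))))
  where
  nonempty⇔positive : ∀ s → (if does (ℤ.+ 0 ℤ.≤? ℤ.+ s ℤ.- ℤ.+ 1) then w (ℤ.+ s ℤ.- ℤ.+ 1) else 0)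
                           ≡ ((λ s → w (ℤ.+ s ℤ.- ℤ.+ 1)) ⁺) s
  nonempty⇔positive zero    = refl
  nonempty⇔positive (suc s) = refl

faceSum-T×T : ∀ p q (w : ℤ → ℕ) → faceSum (T p ×ₚ T q) w ≡
  w -[1+ 0 ] + ∑⊆⁺ (suc p) (λ s → ∑⊆⁺ (suc q) (λ t → w ((ℤ.+ s ℤ.- ℤ.+ 1) ℤ.+ (ℤ.+ t ℤ.- ℤ.+ 1))))
faceSum-T×T p q w = trans (faceSum-×ₚ (T p) (T q) w) (cong (w -[1+ 0 ] +_)
  (trans (faceSum⁺-T p _) (∑⊆⁺-cong (suc p) λ s → faceSum⁺-T q _)))

-- A k-face of the r-fold pyramid over T p × T q is either a set of k+1 apices, or the
-- join of a set A of apices with S × S' for nonempty vertex sets with |A| + |S| + |S'| = k+2.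
f-pyrIter-T×T≡∑⊆ : ∀ r p q k → f k (pyrIter r (T p ×ₚ T q)) ≡
  r C suc k + ∑⊆ r (λ a → ∑⊆⁺ (suc p) (λ s → ∑⊆⁺ (suc q) (λ t → 𝟙 (a + (s + t) ≡ᵇ suc (suc k)))))
f-pyrIter-T×T≡∑⊆ r p q k = begin
  f k (pyrIter r (T p ×ₚ T q))
    ≡⟨ f≡faceSum k (pyrIter r (T p ×ₚ T q)) ⟩
  faceSum (pyrIter r (T p ×ₚ T q)) δ
    ≡⟨ faceSum-pyrIter r (T p ×ₚ T q) δ ⟩
  ∑⊆ r (λ a → faceSum (T p ×ₚ T q) (λ z → δ (z ℤ.+ ℤ.+ a)))
    ≡⟨ ∑⊆-cong r apex-layer ⟩
  ∑⊆ r (λ a → 𝟙 (a ≡ᵇ suc k) + Y a)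
    ≡⟨ ∑⊆-+ r (λ a → 𝟙 (a ≡ᵇ suc k)) Y ⟩
  ∑⊆ r (λ a → 𝟙 (a ≡ᵇ suc k)) + ∑⊆ r Y
    ≡⟨ cong (_+ ∑⊆ r Y) (∑⊆-indicator r (suc k)) ⟩
  r C suc k + ∑⊆ r Y ∎
  where
  open ≡-Reasoning
  δ : ℤ → ℕ
  δ z = 𝟙 (does (z ℤ.≟ ℤ.+ k))
  Y : ℕ → ℕ
  Y a = ∑⊆⁺ (suc p) (λ s → ∑⊆⁺ (suc q) (λ t → 𝟙 (a + (s + t) ≡ᵇ suc (suc k))))
  empty-face : ∀ a → δ (-[1+ 0 ] ℤ.+ ℤ.+ a) ≡ 𝟙 (a ≡ᵇ suc k)
  empty-face zero    = refl
  empty-face (suc a) = refl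
  size : ∀ a s t → 2 + (s + t + a) ≡ a + (suc s + suc t)
  size = solve-∀
  apex-layer : ∀ a → faceSum (T p ×ₚ T q) (λ z → δ (z ℤ.+ ℤ.+ a)) ≡ 𝟙 (a ≡ᵇ suc k) + Y a
  apex-layer a = trans (faceSum-T×T p q (λ z → δ (z ℤ.+ ℤ.+ a))) (cong₂ _+_ (empty-face a)
    (∑⊆⁺-cong (suc p) λ s → ∑⊆⁺-cong (suc q) λ t → cong (λ x → 𝟙 (x ≡ᵇ suc (suc k))) (size a s t)))

f-pyrIter-T×T : ∀ r p q k →
  f k (pyrIter r (T p ×ₚ T q)) + (r + suc p) C suc (suc k) + (r + suc q) C suc (suc k)
    ≡ (r + (suc p + suc q)) C suc (suc k) + suc r C suc (suc k)
f-pyrIter-T×T r p q k = begin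
  f k (pyrIter r (T p ×ₚ T q)) + (r + suc p) C K + (r + suc q) C K
    ≡⟨ cong₂ _+_ (cong₂ _+_ (f-pyrIter-T×T≡∑⊆ r p q k) (sym (∑⊆-shift (suc p)))) (sym (∑⊆-shift (suc q))) ⟩
  r C suc k + ∑⊆ r Y + ∑⊆ r (H (suc p)) + ∑⊆ r (H (suc q))
    ≡⟨ reassociate (r C suc k) (∑⊆ r Y) _ _ ⟩
  r C suc k + (∑⊆ r Y + ∑⊆ r (H (suc p)) + ∑⊆ r (H (suc q)))
    ≡⟨ cong (r C suc k +_) (trans (∑⊆-+ r (λ a → Y a + H (suc p) a) (H (suc q)))
                                       (cong (_+ ∑⊆ r (H (suc q))) (∑⊆-+ r Y (H (suc p))))) ⟨
  r C suc k + ∑⊆ r (λ a → Y a + H (suc p) a + H (suc q) a)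
    ≡⟨ cong (r C suc k +_) (trans (∑⊆-cong r pairs) (∑⊆-+ r (H (suc p + suc q)) (λ a → ι (a + 0)))) ⟩
  r C suc k + (∑⊆ r (H (suc p + suc q)) + ∑⊆ r (λ a → ι (a + 0)))
    ≡⟨ cong₂ (λ x y → r C suc k + (x + y)) (∑⊆-shift (suc p + suc q)) shift-0 ⟩
  r C suc k + ((r + (suc p + suc q)) C K + r C K)
    ≡⟨ pascal ⟩
  (r + (suc p + suc q)) C K + suc r C K ∎
  where
  open ≡-Reasoning
  K : ℕ
  K = suc (suc k)
  ι : ℕ → ℕ
  ι x = 𝟙 (x ≡ᵇ K)
  Y : ℕ → ℕ
  Y a = ∑⊆⁺ (suc p) (λ s → ∑⊆⁺ (suc q) (λ t → ι (a + (s + t))))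
  H : ℕ → ℕ → ℕ
  H n a = ∑⊆ n (λ x → ι (a + x))
  ∑⊆-shift : ∀ n → ∑⊆ r (H n) ≡ (r + n) C K
  ∑⊆-shift n = trans (∑⊆-convolution r n ι) (∑⊆-indicator (r + n) K)
  shift-0 : ∑⊆ r (λ a → ι (a + 0)) ≡ r C K
  shift-0 = trans (∑⊆-cong r λ a → cong ι (+-identityʳ a)) (∑⊆-indicator r K)
  pairs : ∀ a → Y a + H (suc p) a + H (suc q) a ≡ H (suc p + suc q) a + ι (a + 0)
  pairs a = ∑⊆⁺-pairs (suc p) (suc q) (λ x → ι (a + x))
  reassociate : ∀ c y u v → c + y + u + v ≡ c + (y + u + v)
  reassociate = solve-∀
  pascal : r C suc k + ((r + (suc p + suc q)) C K + r C K) ≡ (r + (suc p + suc q)) C K + suc r C K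
  pascal = begin
    r C suc k + (N + r C K)  ≡⟨ swap (r C suc k) N (r C K) ⟩
    N + (r C suc k + r C K)  ≡⟨ cong (N +_) (nCk+nC[k+1]≡[n+1]C[k+1] r (suc k)) ⟩
    N + suc r C K            ∎
    where
    N : ℕ
    N = (r + (suc p + suc q)) C K
    swap : ∀ a b c → a + (b + c) ≡ b + (a + c)
    swap = solve-∀

nCk≤[1+n]Ck : ∀ n k → n C k ≤ suc n C k
nCk≤[1+n]Ck n zero    = ≤-refl
nCk≤[1+n]Ck n (suc k) = subst (n C suc k ≤_) (nCk+nC[k+1]≡[n+1]C[k+1] n k) (m≤n+m (n C suc k) (n C k))

C-monoˡ-≤ : ∀ {m n} k → m ≤ n → m C k ≤ n C k
C-monoˡ-≤ k m≤n = go (≤⇒≤′ m≤n)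
  where
  go : ∀ {m n} → m ≤′ n → m C k ≤ n C k
  go ≤′-refl        = ≤-refl
  go (≤′-step m≤′n) = ≤-trans (go m≤′n) (nCk≤[1+n]Ck _ k)

nCk>0 : ∀ {n k} → k ≤ n → 0 < n C k
nCk>0 {n} {k} k≤n = subst (_≤ n C k) (nCn≡1 k) (C-monoˡ-≤ k k≤n)

C-monoˡ-< : ∀ {m n} k → m < n → suc k ≤ n → m C suc k < n C suc k
C-monoˡ-< {m} {suc n} k (s≤s m≤n) (s≤s k≤n) = begin-strict
  m C suc k              ≤⟨ C-monoˡ-≤ (suc k) m≤n ⟩
  n C suc k              <⟨ m<n+m (n C suc k) (nCk>0 k≤n) ⟩
  n C k + n C suc k      ≡⟨ nCk+nC[k+1]≡[n+1]C[k+1] n k ⟩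
  suc n C suc k          ∎
  where open ≤-Reasoning

C-supermodular-+ : ∀ n i j k → (i + n) C k + (j + n) C k ≤ (j + (i + n)) C k + n C k
C-supermodular-+ n i zero    k       = ≤-refl
C-supermodular-+ n i (suc j) zero    = ≤-refl
C-supermodular-+ n i (suc j) (suc k) = begin
  (i + n) C suc k + suc (j + n) C suc k
    ≡⟨ cong ((i + n) C suc k +_) (nCk+nC[k+1]≡[n+1]C[k+1] (j + n) k) ⟨
  (i + n) C suc k + ((j + n) C k + (j + n) C suc k)
    ≡⟨ shuffle ((i + n) C suc k) ((j + n) C k) ((j + n) C suc k) ⟩
  ((i + n) C suc k + (j + n) C suc k) + (j + n) C k
    ≤⟨ +-mono-≤ (C-supermodular-+ n i j (suc k)) (C-monoˡ-≤ k (+-monoʳ-≤ j (m≤n+m n i))) ⟩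
  ((j + (i + n)) C suc k + n C suc k) + (j + (i + n)) C k
    ≡⟨ shuffle′ ((j + (i + n)) C suc k) (n C suc k) ((j + (i + n)) C k) ⟩
  ((j + (i + n)) C k + (j + (i + n)) C suc k) + n C suc k
    ≡⟨ cong (_+ n C suc k) (nCk+nC[k+1]≡[n+1]C[k+1] (j + (i + n)) k) ⟩
  suc (j + (i + n)) C suc k + n C suc k ∎
  where
  open ≤-Reasoning
  shuffle : ∀ a b c → a + (b + c) ≡ a + c + b
  shuffle = solve-∀
  shuffle′ : ∀ a b c → a + b + c ≡ c + a + b
  shuffle′ = solve-∀

C-supermodular : ∀ {n x y z} k → n ≤ x → n ≤ y → x + y ≡ n + z → x C k + y C k ≤ z C k + n C k
C-supermodular {n} {x} {y} {z} k n≤x n≤y x+y≡n+z =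
  subst₂ (λ u v → u C k + v C k ≤ z C k + n C k) x≡ y≡
    (subst (λ w → (i + n) C k + (j + n) C k ≤ w C k + n C k) z≡ (C-supermodular-+ n i j k))
  where
  i j : ℕ
  i = x ∸ n
  j = y ∸ n
  x≡ : i + n ≡ x
  x≡ = m∸n+n≡m n≤x
  y≡ : j + n ≡ y
  y≡ = m∸n+n≡m n≤y
  z≡ : j + (i + n) ≡ z
  z≡ = +-cancelˡ-≡ n _ _ (trans (regroup n i j) (trans (cong₂ _+_ x≡ y≡) x+y≡n+z))
    where
    regroup : ∀ n i j → n + (j + (i + n)) ≡ i + n + (j + n)
    regroup = solve-∀

-- With D = r₀ + q₀ = r + m + q − 2: supermodularity bounds the left side by
-- D C K + (r+4) C K + (r₀+1) C K ≤ D C K + (r₀+4) C K + (r+1) C K, and Pascal's rule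
-- at r₀ + 3 < D (here 4 ≤ q₀ is needed) makes the last step strict.
binomial-inequality : ∀ {r m q r₀ q₀} k → r + (m + q) ≡ r₀ + (2 + q₀) →
  3 ≤ m → 3 ≤ q → 4 ≤ q₀ → r ≤ r₀ → k + 3 ≤ r₀ + (2 + q₀) →
  (r + suc m) C suc (suc k) + (r + suc q) C suc (suc k) + suc r₀ C suc (suc k)
    < (r₀ + 3) C suc (suc k) + (r₀ + suc q₀) C suc (suc k) + suc r C suc (suc k)
binomial-inequality {r} {m} {q} {r₀} {q₀} k r+m+q≡r₀+2+q₀ 3≤m 3≤q 4≤q₀ r≤r₀ k+3≤d = begin-strict
  (r + suc m) C K + (r + suc q) C K + suc r₀ C K
    ≤⟨ +-monoˡ-≤ (suc r₀ C K) outer ⟩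
  D C K + (r + 4) C K + suc r₀ C K
    ≡⟨ +-assoc (D C K) ((r + 4) C K) (suc r₀ C K) ⟩
  D C K + ((r + 4) C K + suc r₀ C K)
    ≤⟨ +-monoʳ-≤ (D C K) inner ⟩
  D C K + ((r₀ + 4) C K + suc r C K)
    ≡⟨ cong (λ x → D C K + (x + suc r C K)) pascal-r₀ ⟩
  D C K + ((r₀ + 3) C suc k + (r₀ + 3) C K + suc r C K)
    <⟨ +-monoʳ-< (D C K) (+-monoˡ-< (suc r C K) (+-monoˡ-< ((r₀ + 3) C K) (C-monoˡ-< k r₀+3<D 1+k≤D))) ⟩
  D C K + (D C suc k + (r₀ + 3) C K + suc r C K)
    ≡⟨ regroup (D C K) (D C suc k) ((r₀ + 3) C K) (suc r C K) ⟩
  (r₀ + 3) C K + (D C suc k + D C K) + suc r C K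
    ≡⟨ cong (λ x → (r₀ + 3) C K + x + suc r C K) pascal-D ⟩
  (r₀ + 3) C K + (r₀ + suc q₀) C K + suc r C K ∎
  where
  open ≤-Reasoning
  K : ℕ
  K = suc (suc k)
  D : ℕ
  D = r₀ + q₀
  outer : (r + suc m) C K + (r + suc q) C K ≤ D C K + (r + 4) C K
  outer = C-supermodular K (+-monoʳ-≤ r (s≤s 3≤m)) (+-monoʳ-≤ r (s≤s 3≤q))
    (trans (split r m q) (trans (cong (2 + r +_) r+m+q≡r₀+2+q₀) (merge r r₀ q₀)))
    where
    split : ∀ r m q → r + suc m + (r + suc q) ≡ 2 + r + (r + (m + q))
    split = solve-∀
    merge : ∀ r r₀ q₀ → 2 + r + (r₀ + (2 + q₀)) ≡ r + 4 + (r₀ + q₀)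
    merge = solve-∀
  inner : (r + 4) C K + suc r₀ C K ≤ (r₀ + 4) C K + suc r C K
  inner = C-supermodular K (subst (_≤ r + 4) (+-comm r 1) (+-monoʳ-≤ r (s≤s z≤n))) (s≤s r≤r₀) (sum r r₀)
    where
    sum : ∀ r r₀ → r + 4 + suc r₀ ≡ suc r + (r₀ + 4)
    sum = solve-∀
  pascal-r₀ : (r₀ + 4) C K ≡ (r₀ + 3) C suc k + (r₀ + 3) C K
  pascal-r₀ = sym (trans (nCk+nC[k+1]≡[n+1]C[k+1] (r₀ + 3) (suc k)) (cong (_C K) (sym (+-suc r₀ 3))))
  pascal-D : D C suc k + D C K ≡ (r₀ + suc q₀) C K
  pascal-D = trans (nCk+nC[k+1]≡[n+1]C[k+1] D (suc k)) (cong (_C K) (sym (+-suc r₀ q₀)))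
  r₀+3<D : r₀ + 3 < D
  r₀+3<D = +-monoʳ-< r₀ 4≤q₀
  1+k≤D : suc k ≤ D
  1+k≤D = +-cancelˡ-≤ 2 (suc k) D (subst₂ _≤_ (+-comm k 3) (lift r₀ q₀) k+3≤d)
    where
    lift : ∀ r₀ q₀ → r₀ + (2 + q₀) ≡ 2 + (r₀ + q₀)
    lift = solve-∀
  regroup : ∀ a b c d → a + (b + c + d) ≡ c + (b + a) + d
  regroup = solve-∀

<-by-balance : ∀ {x y n a b c a′ b′ c′} → x + a + b ≡ n + c → y + a′ + b′ ≡ n + c′ →
  a′ + b′ + c < a + b + c′ → x < y
<-by-balance {x} {y} {n} {a} {b} {c} {a′} {b′} {c′} x-balance y-balance lt =
  +-cancelʳ-< (a + b + c′) x y (begin-strict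
    x + (a + b + c′)   ≡⟨ trans (regroup x a b c′) (cong (_+ c′) x-balance) ⟩
    n + c + c′         ≡⟨ swap n c c′ ⟩
    n + c′ + c         ≡⟨ trans (regroup y a′ b′ c) (cong (_+ c) y-balance) ⟨
    y + (a′ + b′ + c)  <⟨ +-monoʳ-< y lt ⟩
    y + (a + b + c′)   ∎)
  where
  open ≤-Reasoning
  regroup : ∀ x a b c → x + (a + b + c) ≡ x + a + b + c
  regroup = solve-∀
  swap : ∀ n c c′ → n + c + c′ ≡ n + c′ + c
  swap = solve-∀

f-pyr[T2×T3]<f-T3×T3 : ∀ k → k ≤ 3 → f k (pyr (T 2 ×ₚ T 3)) < f k (T 3 ×ₚ T 3)
f-pyr[T2×T3]<f-T3×T3 0 _ = toWitness {a? = _ <? _} _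
f-pyr[T2×T3]<f-T3×T3 1 _ = toWitness {a? = _ <? _} _
f-pyr[T2×T3]<f-T3×T3 2 _ = toWitness {a? = _ <? _} _
f-pyr[T2×T3]<f-T3×T3 3 _ = toWitness {a? = _ <? _} _
f-pyr[T2×T3]<f-T3×T3 (suc (suc (suc (suc _)))) (s≤s (s≤s (s≤s ())))

m≤n/2⇒m+m≤n : ∀ {m n} → m ≤ n / 2 → m + m ≤ n
m≤n/2⇒m+m≤n {m} {n} m≤n/2 =
  ≤-trans (≤-reflexive (double m)) (≤-trans (*-monoˡ-≤ 2 m≤n/2) (m/n*n≤m n 2))
  where
  double : ∀ m → m + m ≡ m * 2
  double = solve-∀

proposition2p5 : (d b m : ℕ) → 6 ≤ d →
    ((d + 3) / 2 + 1) ≤ b → b ≤ d → 3 ≤ m → m ≤ b / 2 →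
    (k : ℕ) → k ≤ d ∸ 3 →
    f k (pyrIter (d ∸ ((d + 3) / 2 + 1)) (T 2 ×ₚ T (((d + 3) / 2 + 1) ∸ 2)))
    < f k (pyrIter (d ∸ b) (T m ×ₚ T (b ∸ m)))
proposition2p5 d b m 6≤d a≤b b≤d 3≤m m≤b/2 k k≤d∸3 with m≤n⇒m<n∨m≡n 6≤d
... | inj₂ refl
  with refl ← ≤-antisym b≤d (≤-trans (+-mono-≤ 3≤m 3≤m) (m≤n/2⇒m+m≤n m≤b/2))
  with refl ← ≤-antisym m≤b/2 3≤m = f-pyr[T2×T3]<f-T3×T3 k k≤d∸3
... | inj₁ 7≤d =
  <-by-balance (f-pyrIter-T×T r₀ 2 q₀ k)
               (trans (f-pyrIter-T×T r m q k) (cong (λ n → n C suc (suc k) + suc r C suc (suc k)) same-size))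
               (binomial-inequality k r+m+q≡r₀+2+q₀ 3≤m 3≤q 4≤q₀ r≤r₀ (subst (k + 3 ≤_) d≡r₀+2+q₀ k+3≤d))
  where
  a r q r₀ q₀ : ℕ
  a = (d + 3) / 2 + 1
  r = d ∸ b
  q = b ∸ m
  r₀ = d ∸ a
  q₀ = a ∸ 2
  6≤a : 6 ≤ a
  6≤a = +-monoˡ-≤ 1 (/-monoˡ-≤ 2 (+-monoˡ-≤ 3 7≤d))
  m+m≤b : m + m ≤ b
  m+m≤b = m≤n/2⇒m+m≤n m≤b/2
  3≤q : 3 ≤ q
  3≤q = ≤-trans 3≤m (m+n≤o⇒m≤o∸n m m+m≤b)
  4≤q₀ : 4 ≤ q₀
  4≤q₀ = ∸-monoˡ-≤ 2 6≤a
  r≤r₀ : r ≤ r₀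
  r≤r₀ = ∸-monoʳ-≤ d a≤b
  k+3≤d : k + 3 ≤ d
  k+3≤d = ≤-trans (+-monoˡ-≤ 3 k≤d∸3) (≤-reflexive (m∸n+n≡m (≤-trans (s≤s (s≤s (s≤s z≤n))) 6≤d)))
  d≡r₀+2+q₀ : d ≡ r₀ + (2 + q₀)
  d≡r₀+2+q₀ = trans (sym (m∸n+n≡m (≤-trans a≤b b≤d))) (cong (r₀ +_) (sym (m+[n∸m]≡n (≤-trans (s≤s (s≤s z≤n)) 6≤a))))
  r+m+q≡r₀+2+q₀ : r + (m + q) ≡ r₀ + (2 + q₀)
  r+m+q≡r₀+2+q₀ = trans (cong (r +_) (m+[n∸m]≡n (≤-trans (m≤m+n m m) m+m≤b))) (trans (m∸n+n≡m b≤d) d≡r₀+2+q₀)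
  same-size : r + (suc m + suc q) ≡ r₀ + (3 + suc q₀)
  same-size = trans (two-more r m q) (trans (cong (2 +_) r+m+q≡r₀+2+q₀) (sym (two-more r₀ 2 q₀)))
    where
    two-more : ∀ x y z → x + (suc y + suc z) ≡ 2 + (x + (y + z))
    two-more = solve-∀
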